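{- For every integer $k\ge 2$, $\rho(k)\ge \frac{k^2}{2}+\frac{3k}{2}-2$.
   Context: For a positive integer $k$, $\rho(k)$ denotes the length of the shortest word (finite string) over the alphabet $[k]=\{1,2,\ldots,k\}$ that contains every permutation of $[k]$ as a (not necessarily contiguous) subsequence. -}

module Defs where

open import Data.Nat using (ℕ)
open import Data.Fin using (Fin)
open import Data.List using (List; tabulate)
open import Data.List.Relation.Binary.Sublist.Propositional using (_⊆_)
open import Data.Fin.Permutation using (Permutation′; _⟨$⟩ʳ_)

Word : ℕ → Set
Word k = List (Fin k)

permWord : {k : ℕ} → Permutation′ k → Word k
permWord {k} π = tabulate (π ⟨$⟩ʳ_)

Universal : (k : ℕ) → Word k → Set
Universal k w = (π : Permutation′ k) → permWord π ⊆ w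

-- Let v be universal for an alphabet T of n + 1 letters and let a be the letter whose first
-- occurrence in v comes last, so v = u a r with every other letter in u; hence |u| ≥ n.
-- Every permutation starting with a embeds into r, so r with a erased is universal for the
-- other n letters, and ρ(n + 1) ≥ ρ(n) + n + 1.  For n ≥ 2 one more letter is gained: either
-- |u| > n, or u ends with the first occurrence of some letter b, and then embedding a
-- permutation b c … a forces a second a in r.  So ρ(n + 1) ≥ ρ(n) + n + 2 for n ≥ 2, and with
-- ρ(2) = 3 this sums to 2 ρ(k) ≥ k² + 3k − 4.
module Submission where

open import Data.Empty using (⊥-elim)
open import Data.Fin using (Fin; cast)
import Data.Fin as Fin
open import Data.Fin.Permutation using (permutation)
open import Data.Fin.Properties using (cast-involutive; cast-is-id) renaming (_≟_ to _≟ᶠ_)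
open import Data.List using (List; []; _∷_; _++_; [_]; length; filter; allFin; tabulate; lookup)
open import Data.List.Membership.Propositional using (_∈_; _∉_)
open import Data.List.Membership.Propositional.Properties using (∈-∃++; ∈-++⁺ʳ; ∈-allFin; ∈-lookup)
open import Data.List.Properties
  using (length-++; ++-assoc; length-filter; filter-all; filter-notAll;
         length-tabulate; tabulate-cong; tabulate-lookup)
open import Data.List.Relation.Binary.Permutation.Propositional
  using (_↭_; ↭-refl; ↭-sym; ↭-trans; ↭-prep; ↭-swap; ↭⇒↭ₛ)
open import Data.List.Relation.Binary.Permutation.Propositional.Properties
  using (shift; ↭-length; ∈-resp-↭; All-resp-↭; ++-comm)
import Data.List.Relation.Binary.Permutation.Setoid.Properties as Permutationₛ
open import Data.List.Relation.Binary.Sublist.Propositional using (_⊆_)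
open import Data.List.Relation.Binary.Sublist.Propositional.Properties
  using (∷⁻; ∷ʳ⁻; Any-resp-⊆; length-mono-≤; filter⁺)
open import Data.List.Relation.Unary.All using (All; []; _∷_)
import Data.List.Relation.Unary.All as All
open import Data.List.Relation.Unary.All.Properties using (All¬⇒¬Any)
open import Data.List.Relation.Unary.AllPairs using ([]; _∷_)
open import Data.List.Relation.Unary.Any using (here; there; index)
import Data.List.Relation.Unary.Any as Any
open import Data.List.Relation.Unary.Any.Properties using (lookup-index)
open import Data.List.Relation.Unary.Unique.Propositional using (Unique)
open import Data.List.Relation.Unary.Unique.Propositional.Properties using (allFin⁺)
open import Data.Nat using (ℕ; zero; suc; _+_; _*_; _∸_; _≤_; _<_; z≤n; s≤s; s≤s⁻¹)
open import Data.Nat.Properties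
  using (+-comm; +-suc; suc-injective; ≤-trans; ≤-reflexive; +-mono-≤; +-monoˡ-≤; +-monoʳ-≤; *-monoʳ-≤;
         m≤n+o⇒m∸n≤o; module ≤-Reasoning)
open import Data.Nat.Tactic.RingSolver using (solve-∀)
open import Data.Product using (∃; _,_)
open import Data.Sum using (_⊎_; inj₁; inj₂)
open import Function using (_∘_; id)
open import Relation.Binary.Definitions using (DecidableEquality)
open import Relation.Binary.PropositionalEquality
  using (_≡_; _≢_; refl; sym; trans; cong; subst; ≢-sym; setoid)
open import Relation.Nullary using (¬?; yes; no)
open import Relation.Unary using (Decidable)

open import Defs

module _ {A : Set} where

  private variable
    a b x y : A
    p r u v T T′ xs ys : List A

  Unique-resp-↭ : xs ↭ ys → Unique xs → Unique ys
  Unique-resp-↭ σ = Permutationₛ.Unique-resp-↭ (setoid _) (↭⇒↭ₛ σ)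

  ∈-∷⁻ : y ∈ x ∷ xs → y ≢ x → y ∈ xs
  ∈-∷⁻ (here y≡x)   y≢x = ⊥-elim (y≢x y≡x)
  ∈-∷⁻ (there y∈xs) _   = y∈xs

  ∈-↭-∷⁻ : x ∷ xs ↭ ys → y ∈ ys → y ≢ x → y ∈ xs
  ∈-↭-∷⁻ σ y∈ys = ∈-∷⁻ (∈-resp-↭ (↭-sym σ) y∈ys)

  ∈⇒∷-↭ : x ∈ ys → ∃ λ xs → x ∷ xs ↭ ys
  ∈⇒∷-↭ x∈ys with ys₁ , ys₂ , refl ← ∈-∃++ x∈ys = ys₁ ++ ys₂ , ↭-sym (shift _ ys₁ ys₂)

  unique-length-≤ : Unique xs → All (_∈ ys) xs → length xs ≤ length ys
  unique-length-≤ []               []             = z≤n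
  unique-length-≤ {x ∷ xs} (x≢xs ∷ unique) (x∈ys ∷ xs⊆ys) with ys′ , σ ← ∈⇒∷-↭ x∈ys =
    subst (suc (length xs) ≤_) (↭-length σ) (s≤s (unique-length-≤ unique xs⊆ys′))
    where
    xs⊆ys′ : All (_∈ ys′) xs
    xs⊆ys′ = All.zipWith (λ (y∈ys , x≢y) → ∈-↭-∷⁻ σ y∈ys (≢-sym x≢y)) (xs⊆ys , x≢xs)

  lookup-injective : Unique xs → ∀ i j → lookup xs i ≡ lookup xs j → i ≡ j
  lookup-injective (_    ∷ _)      Fin.zero    Fin.zero    _  = refl
  lookup-injective (x≢xs ∷ _)      Fin.zero    (Fin.suc j) eq =
    ⊥-elim (All.lookup x≢xs (∈-lookup j) eq)
  lookup-injective (x≢xs ∷ _)      (Fin.suc i) Fin.zero    eq =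
    ⊥-elim (All.lookup x≢xs (∈-lookup i) (sym eq))
  lookup-injective (_    ∷ unique) (Fin.suc i) (Fin.suc j) eq =
    cong Fin.suc (lookup-injective unique i j eq)

  tabulate-lookup-cast : ∀ (xs : List A) {n} (eq : n ≡ length xs) → tabulate (lookup xs ∘ cast eq) ≡ xs
  tabulate-lookup-cast xs refl =
    trans (tabulate-cong (λ i → cong (lookup xs) (cast-is-id refl i))) (tabulate-lookup xs)

  ⊆-after-first-occurrence : ∀ u → x ∉ u → x ∷ p ⊆ u ++ x ∷ r → p ⊆ r
  ⊆-after-first-occurrence []      _   τ = ∷⁻ τ
  ⊆-after-first-occurrence (y ∷ u) x∉u τ =
    ⊆-after-first-occurrence u (x∉u ∘ there) (∷ʳ⁻ (x∉u ∘ here) τ)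

  UniversalFor : List A → List A → Set
  UniversalFor T v = ∀ {p} → p ↭ T → p ⊆ v

  length-≤-universal : UniversalFor T v → length T ≤ length v
  length-≤-universal U = length-mono-≤ (U ↭-refl)

  all-∈-universal : UniversalFor T v → All (_∈ v) T
  all-∈-universal U = All.tabulate (Any-resp-⊆ (U ↭-refl))

  universal-after-first-occurrence : UniversalFor T (u ++ a ∷ r) → a ∉ u → a ∷ T′ ↭ T → UniversalFor T′ r
  universal-after-first-occurrence {u = u} U a∉u σ τ =
    ⊆-after-first-occurrence u a∉u (U (↭-trans (↭-prep _ τ) σ))

  letter-repeats : UniversalFor T (u ++ b ∷ a ∷ r) → b ∉ u → b ∷ a ∷ xs ↭ T → 1 ≤ length xs → a ∈ r
  letter-repeats {T = T} {u = u} {b = b} {a = a} {xs = c ∷ cs} U b∉u σ _ =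
    Any-resp-⊆ (∷⁻ (⊆-after-first-occurrence u b∉u (U b∷c∷cs∷a))) (∈-++⁺ʳ cs (here refl))
    where
    b∷c∷cs∷a : b ∷ (c ∷ cs ++ [ a ]) ↭ T
    b∷c∷cs∷a = ↭-trans (↭-prep b (++-comm (c ∷ cs) [ a ])) σ

  record LastNewLetter (T v : List A) : Set where
    field
      letter        : A
      others        : List A
      prefix        : List A
      suffix        : List A
      letter∷others : letter ∷ others ↭ T
      split         : v ≡ prefix ++ letter ∷ suffix
      letter∉prefix : letter ∉ prefix
      others⊆prefix : All (_∈ prefix) others

  record Reduction (n : ℕ) (v : List A) : Set where
    field
      alphabet        : List A
      word            : List A
      alphabet-unique : Unique alphabet
      length-alphabet : length alphabet ≡ n
      universal       : UniversalFor alphabet word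
      shorter         : n + suc (length word) ≤ length v
      much-shorter    : 2 ≤ n → suc n + suc (length word) ≤ length v

module _ {A : Set} (_≟_ : DecidableEquality A) where

  open import Data.List.Membership.DecPropositional _≟_ using (_∈?_)

  private variable
    a : A
    n : ℕ
    r u v T T′ : List A

  lastNewLetter : ∀ {t ts v} → Unique (t ∷ ts) → All (_∈ v) (t ∷ ts) → LastNewLetter (t ∷ ts) v
  lastNewLetter {v = []} _ (() ∷ _)
  lastNewLetter {t = t} {ts} {x ∷ v} unique T⊆x∷v with x ∈? t ∷ ts
  ... | no x∉T = record
    { letter        = L.letter
    ; others        = L.others
    ; prefix        = x ∷ L.prefix
    ; suffix        = L.suffix
    ; letter∷others = L.letter∷others
    ; split         = cong (x ∷_) L.split
    ; letter∉prefix = λ { (here eq)  → x∉T (subst (_∈ _) eq (∈-resp-↭ L.letter∷others (here refl)))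
                        ; (there m) → L.letter∉prefix m }
    ; others⊆prefix = All.map there L.others⊆prefix
    }
    where
    T⊆v : All (_∈ v) (t ∷ ts)
    T⊆v = All.tabulate (λ y∈T → ∈-∷⁻ (All.lookup T⊆x∷v y∈T) λ { refl → x∉T y∈T })
    module L = LastNewLetter (lastNewLetter unique T⊆v)
  ... | yes x∈T with ∈⇒∷-↭ x∈T
  ... | [] , σ = record
    { letter = x ; others = [] ; prefix = [] ; suffix = v ; letter∷others = σ
    ; split = refl ; letter∉prefix = λ () ; others⊆prefix = [] }
  ... | T₀@(_ ∷ _) , σ with x≢T₀ ∷ unique₀ ← Unique-resp-↭ (↭-sym σ) unique = record
    { letter        = L.letter
    ; others        = x ∷ L.others
    ; prefix        = x ∷ L.prefix
    ; suffix        = L.suffix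
    ; letter∷others = ↭-trans (↭-swap _ _ ↭-refl) (↭-trans (↭-prep x L.letter∷others) σ)
    ; split         = cong (x ∷_) L.split
    ; letter∉prefix = λ { (here eq)  → All.lookup x≢T₀ (∈-resp-↭ L.letter∷others (here refl)) (sym eq)
                        ; (there m) → L.letter∉prefix m }
    ; others⊆prefix = here refl ∷ All.map there L.others⊆prefix
    }
    where
    T₀⊆v : All (_∈ v) T₀
    T₀⊆v = All.tabulate (λ y∈T₀ →
      ∈-∷⁻ (All.lookup T⊆x∷v (∈-resp-↭ σ (there y∈T₀))) λ { refl → All.lookup x≢T₀ y∈T₀ refl })
    module L = LastNewLetter (lastNewLetter unique₀ T₀⊆v)

  long-prefix-or-letter-repeats : Unique T′ → UniversalFor T (u ++ a ∷ r) → a ∷ T′ ↭ T →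
                                  All (_∈ u) T′ → 2 ≤ length T′ →
                                  suc (length T′) ≤ length u ⊎ a ∈ r
  long-prefix-or-letter-repeats {T′ = []} _ _ _ _ ()
  long-prefix-or-letter-repeats {T′ = T′@(_ ∷ _)} {T = T} {a = a} {r = r} unique U σ T′⊆u 2≤|T′|
    with lastNewLetter unique T′⊆u
  ... | record { letter = b ; others = T″ ; prefix = u′ ; suffix = u″ ; letter∷others = σ′
               ; split = refl ; letter∉prefix = b∉u′ ; others⊆prefix = T″⊆u′ }
    with u″
  ... | [] = inj₂ (letter-repeats U′ b∉u′ b∷a∷T″ 1≤|T″|)
    where
    U′ : UniversalFor T (u′ ++ b ∷ a ∷ r)
    U′ = subst (UniversalFor T) (++-assoc u′ [ b ] (a ∷ r)) U
    b∷a∷T″ : b ∷ a ∷ T″ ↭ T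
    b∷a∷T″ = ↭-trans (↭-swap b a ↭-refl) (↭-trans (↭-prep a σ′) σ)
    1≤|T″| : 1 ≤ length T″
    1≤|T″| = s≤s⁻¹ (subst (2 ≤_) (sym (↭-length σ′)) 2≤|T′|)
  ... | c ∷ cs = inj₁ (begin
    suc (length T′)              ≡⟨ cong suc (sym (↭-length σ′)) ⟩
    2 + length T″                ≡⟨ +-comm 2 (length T″) ⟩
    length T″ + 2                ≤⟨ +-mono-≤ |T″|≤|u′| (s≤s (s≤s z≤n)) ⟩
    length u′ + (2 + length cs)  ≡⟨ sym (length-++ u′) ⟩
    length (u′ ++ b ∷ c ∷ cs)    ∎)
    where
    open ≤-Reasoning
    |T″|≤|u′| : length T″ ≤ length u′
    |T″|≤|u′| with _ ∷ unique″ ← Unique-resp-↭ (↭-sym σ′) unique = unique-length-≤ unique″ T″⊆u′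

  erase : A → List A → List A
  erase a = filter (¬? ∘ (_≟ a))

  length-erase-≤ : ∀ a r → length (erase a r) ≤ length r
  length-erase-≤ a = length-filter (¬? ∘ (_≟ a))

  length-erase-< : a ∈ r → length (erase a r) < length r
  length-erase-< {a = a} {r = r} a∈r =
    filter-notAll (¬? ∘ (_≟ a)) r (Any.map (λ a≡y y≢a → y≢a (sym a≡y)) a∈r)

  universal-erase : a ∉ T → UniversalFor T v → UniversalFor T (erase a v)
  universal-erase {a = a} {v = v} a∉T U {p} τ =
    subst (_⊆ erase a v) (filter-all ≢a? p≢a) (filter⁺ ≢a? ≢a? (λ { refl → id }) (U τ))
    where
    ≢a? : Decidable (_≢ a)
    ≢a? = ¬? ∘ (_≟ a)
    p≢a : All (_≢ a) p
    p≢a = All-resp-↭ (↭-sym τ) (All.tabulate λ y∈T y≡a → a∉T (subst (_∈ _) y≡a y∈T))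

  reduce : Unique T → length T ≡ suc n → UniversalFor T v → Reduction n v
  reduce {T = _ ∷ _} {n = n} unique |T| U with lastNewLetter unique (all-∈-universal U)
  ... | record { letter = a ; others = T′ ; prefix = u ; suffix = r ; letter∷others = σ
               ; split = refl ; letter∉prefix = a∉u ; others⊆prefix = T′⊆u }
    with a≢T′ ∷ unique′ ← Unique-resp-↭ (↭-sym σ) unique = record
    { alphabet        = T′
    ; word            = erase a r
    ; alphabet-unique = unique′
    ; length-alphabet = |T′|
    ; universal       = universal-erase (All¬⇒¬Any a≢T′) (universal-after-first-occurrence U a∉u σ)
    ; shorter         = ≤-trans (+-mono-≤ n≤|u| (s≤s (length-erase-≤ a r))) |v|
    ; much-shorter    = λ 2≤n →
        ≤-trans (extra (long-prefix-or-letter-repeats unique′ U σ T′⊆u (2≤|T′| 2≤n))) |v|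
    }
    where
    open ≤-Reasoning
    |T′| : length T′ ≡ n
    |T′| = suc-injective (trans (↭-length σ) |T|)
    2≤|T′| : 2 ≤ n → 2 ≤ length T′
    2≤|T′| = subst (2 ≤_) (sym |T′|)
    n≤|u| : n ≤ length u
    n≤|u| = subst (_≤ length u) |T′| (unique-length-≤ unique′ T′⊆u)
    |v| : length u + suc (length r) ≤ length (u ++ a ∷ r)
    |v| = ≤-reflexive (sym (length-++ u))
    extra : suc (length T′) ≤ length u ⊎ a ∈ r →
            suc n + suc (length (erase a r)) ≤ length u + suc (length r)
    extra (inj₁ |T′|<|u|) =
      +-mono-≤ (subst (λ k → suc k ≤ length u) |T′| |T′|<|u|) (s≤s (length-erase-≤ a r))
    extra (inj₂ a∈r) = begin
      suc n + suc (length (erase a r))    ≡⟨ sym (+-suc n (suc (length (erase a r)))) ⟩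
      n + suc (suc (length (erase a r)))  ≤⟨ +-mono-≤ n≤|u| (s≤s (length-erase-< a∈r)) ⟩
      length u + suc (length r)           ∎

  universal-length-bound : ∀ n → Unique T → length T ≡ 2 + n → UniversalFor T v →
                           (2 + n) * (2 + n) + 3 * (2 + n) ≤ 4 + 2 * length v
  universal-length-bound zero unique |T| U =
    +-monoʳ-≤ 4 (*-monoʳ-≤ 2 (≤-trans (s≤s (s≤s 1≤|w|)) shorter))
    where
    open Reduction (reduce unique |T| U)
    1≤|w| : 1 ≤ length word
    1≤|w| = subst (_≤ length word) length-alphabet (length-≤-universal universal)
  universal-length-bound {v = v} (suc m) unique |T| U = begin
    (3 + m) * (3 + m) + 3 * (3 + m)                  ≡⟨ step m ⟩
    ((2 + m) * (2 + m) + 3 * (2 + m)) + 2 * (4 + m)  ≤⟨ +-monoˡ-≤ (2 * (4 + m)) induction ⟩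
    4 + 2 * length word + 2 * (4 + m)                ≡⟨ regroup m (length word) ⟩
    4 + 2 * (3 + m + suc (length word))              ≤⟨ +-monoʳ-≤ 4 (*-monoʳ-≤ 2 much-shorter′) ⟩
    4 + 2 * length v                                 ∎
    where
    open ≤-Reasoning
    open Reduction (reduce unique |T| U)
    induction : (2 + m) * (2 + m) + 3 * (2 + m) ≤ 4 + 2 * length word
    induction = universal-length-bound m alphabet-unique length-alphabet universal
    much-shorter′ : 3 + m + suc (length word) ≤ length v
    much-shorter′ = much-shorter (s≤s (s≤s z≤n))
    step : ∀ m → (3 + m) * (3 + m) + 3 * (3 + m) ≡ ((2 + m) * (2 + m) + 3 * (2 + m)) + 2 * (4 + m)
    step = solve-∀
    regroup : ∀ m w → 4 + 2 * w + 2 * (4 + m) ≡ 4 + 2 * (3 + m + suc w)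
    regroup = solve-∀

↭-allFin⇒permWord : ∀ {k} (p : List (Fin k)) → p ↭ allFin k → ∃ λ π → permWord π ≡ p
↭-allFin⇒permWord {k} p σ = permutation f g f∘g g∘f , tabulate-lookup-cast p (sym |p|)
  where
  |p| : length p ≡ k
  |p| = trans (↭-length σ) (length-tabulate id)
  p-unique : Unique p
  p-unique = Unique-resp-↭ (↭-sym σ) (allFin⁺ k)
  ∈p : ∀ x → x ∈ p
  ∈p x = ∈-resp-↭ (↭-sym σ) (∈-allFin x)
  f g : Fin k → Fin k
  f i = lookup p (cast (sym |p|) i)
  g x = cast |p| (index (∈p x))
  f∘g : ∀ x → f (g x) ≡ x
  f∘g x = trans (cong (lookup p) (cast-involutive (sym |p|) |p| _)) (sym (lookup-index (∈p x)))
  g∘f : ∀ i → g (f i) ≡ i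
  g∘f i = trans (cong (cast |p|) (lookup-injective p-unique _ _ (sym (lookup-index (∈p (f i))))))
                (cast-involutive |p| (sym |p|) i)

universal-allFin : ∀ {k} {w : Word k} → Universal k w → UniversalFor (allFin k) w
universal-allFin U {p} σ with π , refl ← ↭-allFin⇒permWord p σ = U π

proposition1 : (k : ℕ) → 2 ≤ k → (w : Word k) → Universal k w →
               k * k + 3 * k ∸ 4 ≤ 2 * length w
proposition1 (suc (suc n)) (s≤s (s≤s z≤n)) w U =
  m≤n+o⇒m∸n≤o _ 4 (universal-length-bound _≟ᶠ_ n (allFin⁺ _) (length-tabulate id) (universal-allFin U))
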